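{- Every cograph-tree has NLC-width at most $3$ and clique-width at most $3$.
   Context: A cograph is a graph obtainable from single vertices by repeated disjoint unions and joins (the join of $G_1,G_2$ is their disjoint union plus all edges between $V_{G_1}$ and $V_{G_2}$). For a graph $G$, a vertex $x\in V_G$ and a vertex-disjoint graph $H$, the substitution $G[x/H]$ has vertex set $(V_G\setminus\{x\})\cup V_H$ and edges: those of $G$ not incident to $x$, those of $H$, and $\{u,w\}$ for all $u\in V_H$, $w\in N_G(x)$. Cograph-trees are defined recursively: every tree is a cograph-tree; if $G$ is a cograph-tree, $x\in V_G$ and $H$ is a cograph, then $G[x/H]$ is a cograph-tree. Only graphs obtained this way are cograph-trees. Clique-width: for a positive integer $k$, $\mathrm{CW}_k$ is the smallest class of graphs whose vertices carry labels from $\{1,\dots,k\}$ that contains every single-vertex graph with any label and is closed under: disjoint union; relabeling $\rho_{a\to b}$ for $a\neq b$; and $\eta_{a,b}$ for $a\neq b$ (add all edges between vertices labeled $a$ and vertices labeled $b$). $\operatorname{cw}(G)$ is the least $k$ such that some labeling of $G$ lies in $\mathrm{CW}_k$. NLC-width: $\mathrm{NLC}_k$ is the smallest class of labeled graphs (labels in $\{1,\dots,k\}$) containing every single-vertex graph with any label and closed under: $G\times_S J$ for $S\subseteq\{1,\dots,k\}^2$ (disjoint union of vertex-disjoint $G$ and $J$ plus all edges $\{u,v\}$, $u\in V_G$, $v\in V_J$, $(\mathrm{lab}(u),\mathrm{lab}(v))\in S$); and $\circ_R$ for $R:\{1,\dots,k\}\to\{1,\dots,k\}$. $\operatorname{nlcw}(G)$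 is the least $k$ such that some labeling of $G$ lies in $\mathrm{NLC}_k$. -}

module Defs where

open import Data.Nat using (ℕ; zero; suc; _+_; _≤_)
open import Data.Fin using (Fin; zero; suc; splitAt; punchIn; inject₁; fromℕ; _≟_)
open import Data.Bool using (Bool; true; false; _∧_; _∨_; if_then_else_)
open import Data.Sum using (_⊎_; inj₁; inj₂; [_,_])
open import Data.Product using (Σ; _×_; _,_; ∃)
open import Data.Empty using (⊥)
open import Relation.Nullary using (¬_)
open import Relation.Nullary.Decidable using (⌊_⌋)
open import Relation.Binary.PropositionalEquality using (_≡_; _≢_)
open import Function.Bundles using (_↔_; Inverse)
open import Function.Definitions using (Injective)

Graph : ℕ → Set
Graph n = Fin n → Fin n → Bool

record Simple {n : ℕ} (G : Graph n) : Set where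
  field
    symmetric   : ∀ u v → G u v ≡ G v u
    irreflexive : ∀ u → G u u ≡ false

record _≅_ {n m : ℕ} (G : Graph n) (H : Graph m) : Set where
  field
    bij      : Fin n ↔ Fin m
    preserve : ∀ u v → G u v ≡ H (Inverse.to bij u) (Inverse.to bij v)

data Walk {n : ℕ} (G : Graph n) : Fin n → Fin n → Set where
  here : ∀ {u} → Walk G u u
  step : ∀ {u v w} → G u v ≡ true → Walk G v w → Walk G u w

Connected : ∀ {n} → Graph n → Set
Connected {n} G = ∀ (u v : Fin n) → Walk G u v

-- A cycle of length k+3: distinct vertices c 0, …, c (k+2) with
-- c i ~ c (i+1) and c (k+2) ~ c 0.
record Cycle {n : ℕ} (G : Graph n) : Set where
  field
    k        : ℕ
    c        : Fin (suc (suc (suc k))) → Fin n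
    distinct : Injective _≡_ _≡_ c
    consec   : ∀ (i : Fin (suc (suc k))) → G (c (inject₁ i)) (c (suc i)) ≡ true
    closing  : G (c (fromℕ (suc (suc k)))) (c zero) ≡ true

Acyclic : ∀ {n} → Graph n → Set
Acyclic G = ¬ Cycle G

record IsTree {n : ℕ} (G : Graph n) : Set where
  field
    nonempty  : 1 ≤ n
    simple    : Simple G
    connected : Connected G
    acyclic   : Acyclic G

glue : ∀ {m n} → Graph m → Graph n → (Fin m → Fin n → Bool) → Graph (m + n)
glue {m} G H c u v with splitAt m u | splitAt m v
... | inj₁ i | inj₁ j = G i j
... | inj₁ i | inj₂ j = c i j
... | inj₂ i | inj₁ j = c j i
... | inj₂ i | inj₂ j = H i j

disjointUnion : ∀ {m n} → Graph m → Graph n → Graph (m + n)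
disjointUnion G H = glue G H (λ _ _ → false)

join : ∀ {m n} → Graph m → Graph n → Graph (m + n)
join G H = glue G H (λ _ _ → true)

singleVertex : Graph 1
singleVertex _ _ = false

data CographExpr : ℕ → Set where
  vertex : CographExpr 1
  union  : ∀ {m n} → CographExpr m → CographExpr n → CographExpr (m + n)
  joinE  : ∀ {m n} → CographExpr m → CographExpr n → CographExpr (m + n)

evalCograph : ∀ {n} → CographExpr n → Graph n
evalCograph vertex      = singleVertex
evalCograph (union e f) = disjointUnion (evalCograph e) (evalCograph f)
evalCograph (joinE e f) = join (evalCograph e) (evalCograph f)

IsCograph : ∀ {n} → Graph n → Set
IsCograph {n} H = Σ (CographExpr n) λ e → evalCograph e ≅ H

-- G has vertex set Fin (suc n); the vertices of
-- G other than x are punchIn x i (i : Fin n).  The result has vertex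
-- set Fin (n + m): first the vertices of G - x, then those of H; a
-- vertex of H is adjacent to w ∈ V_G∖{x} iff w ∈ N_G(x).

substitute : ∀ {n m} → Graph (suc n) → Fin (suc n) → Graph m → Graph (n + m)
substitute G x H =
  glue (λ i j → G (punchIn x i) (punchIn x j)) H (λ i _ → G (punchIn x i) x)

syntax substitute G x H = G [ x / H ]

data CographTree : ∀ {n} → Graph n → Set where
  tree  : ∀ {n} {G : Graph n} → IsTree G → CographTree G
  subst : ∀ {n m} {G : Graph (suc n)} {H : Graph m} →
          CographTree G → (x : Fin (suc n)) → IsCograph H →
          CographTree (G [ x / H ])

eqLab : ∀ {k} → Fin k → Fin k → Bool
eqLab a b = ⌊ a ≟ b ⌋

joinLab : ∀ {m n k} → (Fin m → Fin k) → (Fin n → Fin k) → Fin (m + n) → Fin k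
joinLab {m} f g u = [ f , g ] (splitAt m u)

data CWExpr (k : ℕ) : ℕ → Set where
  vertex  : Fin k → CWExpr k 1
  union   : ∀ {m n} → CWExpr k m → CWExpr k n → CWExpr k (m + n)
  relabel : ∀ {n} (a b : Fin k) → a ≢ b → CWExpr k n → CWExpr k n
  eta     : ∀ {n} (a b : Fin k) → a ≢ b → CWExpr k n → CWExpr k n

cwGraph : ∀ {k n} → CWExpr k n → Graph n
cwLab   : ∀ {k n} → CWExpr k n → Fin n → Fin k

cwGraph (vertex a)         = singleVertex
cwGraph (union e f)        = disjointUnion (cwGraph e) (cwGraph f)
cwGraph (relabel a b _ e)  = cwGraph e
cwGraph (eta a b _ e) u v  =
  cwGraph e u v ∨ ((eqLab (cwLab e u) a ∧ eqLab (cwLab e v) b)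
                 ∨ (eqLab (cwLab e u) b ∧ eqLab (cwLab e v) a))

cwLab (vertex a) _          = a
cwLab (union e f)           = joinLab (cwLab e) (cwLab f)
cwLab (relabel a b _ e) u   = if eqLab (cwLab e u) a then b else cwLab e u
cwLab (eta a b _ e)         = cwLab e

-- Some labeling of G lies in CW_k (CW_k is closed under isomorphism,
-- so this means: G is isomorphic to the underlying graph of a
-- k-expression).
InCW : ℕ → ∀ {n} → Graph n → Set
InCW k {n} G = Σ (CWExpr k n) λ e → cwGraph e ≅ G

CliqueWidthAtMost : ℕ → ∀ {n} → Graph n → Set
CliqueWidthAtMost w G = ∃ λ k → 1 ≤ k × k ≤ w × InCW k G

data NLCExpr (k : ℕ) : ℕ → Set where
  vertex  : Fin k → NLCExpr k 1
  times   : ∀ {m n} → (Fin k → Fin k → Bool) →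
            NLCExpr k m → NLCExpr k n → NLCExpr k (m + n)
  relabel : ∀ {n} → (Fin k → Fin k) → NLCExpr k n → NLCExpr k n

nlcGraph : ∀ {k n} → NLCExpr k n → Graph n
nlcLab   : ∀ {k n} → NLCExpr k n → Fin n → Fin k

nlcGraph (vertex a)    = singleVertex
nlcGraph (times S e f) =
  glue (nlcGraph e) (nlcGraph f) (λ u v → S (nlcLab e u) (nlcLab f v))
nlcGraph (relabel R e) = nlcGraph e

nlcLab (vertex a) _      = a
nlcLab (times S e f)     = joinLab (nlcLab e) (nlcLab f)
nlcLab (relabel R e) u   = R (nlcLab e u)

InNLC : ℕ → ∀ {n} → Graph n → Set
InNLC k {n} G = Σ (NLCExpr k n) λ e → nlcGraph e ≅ G

NLCWidthAtMost : ℕ → ∀ {n} → Graph n → Set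
NLCWidthAtMost w G = ∃ λ k → 1 ≤ k × k ≤ w × InNLC k G

{-# OPTIONS --safe #-}
-- A rooted expression builds a graph together with a set of roots: a single
-- vertex is a root, and node link keep a b is the disjoint union of a and b
-- plus, if link, all edges between the roots of a and the roots of b; its
-- roots are those of a and, if keep, those of b.  Labelling roots 0 and the
-- other vertices 1 (with 2 marking the roots of b while a node is formed)
-- turns a rooted expression into an NLC- and a clique-width expression over
-- three labels.  Replacing a vertex y by a rooted expression s whose roots
-- inherit the neighbours of y gives again a rooted expression.  Substituting
-- a cograph (all of whose vertices are roots) is such a replacement, and so
-- is attaching a leaf ℓ to a vertex p of a tree: replace p by the edge p–ℓ
-- rooted at p.  As every tree with at least two vertices has a leaf, every
-- cograph-tree is the graph of a rooted expression.

module Submission where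

open import Defs
open import Data.Nat using (ℕ)
open import Data.Product using (_×_)

open import Data.Bool using (Bool; true; false; _∧_; _∨_; if_then_else_)
import Data.Bool as Bool
open import Data.Bool.Properties using (∧-assoc; ∧-identityʳ; ∧-zeroʳ; ∨-identityʳ; ¬-not)
open import Data.Bool.Solver using (module ∨-∧-Solver)
open import Data.Empty.Polymorphic using (⊥)
open import Data.Fin
  using (Fin; zero; suc; toℕ; fromℕ; inject₁; inject≤; splitAt; punchIn; punchOut; _≟_)
open import Data.Fin.Patterns using (0F; 1F; 2F)
open import Data.Fin.Permutation using (↔⇒≡)
open import Data.Fin.Properties
  using (+↔⊎; 1↔⊤; toℕ-injective; toℕ<n; toℕ-fromℕ; toℕ-inject₁; toℕ-inject≤; inject≤-injective;
         injective⇒≤; any?; all?; punchInᵢ≢i; punchIn-injective; punchOut-cong; punchOut-punchIn;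
         punchIn-punchOut)
open import Data.Nat using (zero; suc; _+_; _≤_; z≤n; s≤s)
open import Data.Nat.Properties using (≤-refl; ≤-trans; ≤-reflexive; <-irrefl; +-suc; m≤m+n)
open import Data.Product using (Σ; Σ-syntax; _,_)
open import Data.Sum using (_⊎_; inj₁; inj₂; [_,_])
import Data.Sum as Sum
open import Data.Sum.Algebra using (⊎-cong; ⊎-comm; ⊎-assoc; ⊎-identityˡ)
open import Data.Sum.Properties using (inj₁-injective)
open import Data.Unit using (⊤; tt)
open import Function using (_∘_; case_of_)
open import Function.Bundles using (_↔_; Inverse; Injection; mk↔ₛ′)
open import Function.Definitions using (Injective)
open import Function.Properties.Inverse using (↔-refl; ↔-sym; ↔-trans; ↔⇒↣)
open import Level using (0ℓ)
open import Relation.Binary.PropositionalEquality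
  using (_≡_; _≢_; refl; sym; trans; cong; cong₂; subst₂; module ≡-Reasoning)
open import Relation.Nullary using (Dec; yes; no; ¬_; ¬?; _×-dec_; contradiction)

open Inverse using (to; from; strictlyInverseˡ; strictlyInverseʳ)

private variable
  A B C : Set
  m n : ℕ

-- Graphs on arbitrary vertex types

Adj : Set → Set
Adj A = A → A → Bool

Preserves : (A → B) → Adj A → Adj B → Set
Preserves f G H = ∀ u v → G u v ≡ H (f u) (f v)

infix 4 _≃_

record _≃_ (G : Adj A) (H : Adj B) : Set where
  field
    bij      : A ↔ B
    preserve : Preserves (to bij) G H

open _≃_

≃-sym : ∀ {G : Adj A} {H : Adj B} → G ≃ H → H ≃ G
≃-sym {H = H} φ = record
  { bij      = ↔-sym (bij φ)
  ; preserve = λ u v → sym (trans (preserve φ _ _)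
                 (cong₂ H (strictlyInverseˡ (bij φ) u) (strictlyInverseˡ (bij φ) v)))
  }

≃-trans : ∀ {G : Adj A} {H : Adj B} {K : Adj C} → G ≃ H → H ≃ K → G ≃ K
≃-trans φ χ = record
  { bij = ↔-trans (bij φ) (bij χ) ; preserve = λ u v → trans (preserve φ u v) (preserve χ _ _) }

≃⇒≅ : ∀ {G : Graph m} {H : Graph n} → G ≃ H → G ≅ H
≃⇒≅ φ = record { bij = bij φ ; preserve = preserve φ }

≅⇒≃ : ∀ {G : Graph m} {H : Graph n} → G ≅ H → G ≃ H
≅⇒≃ φ = record { bij = _≅_.bij φ ; preserve = _≅_.preserve φ }

glue⊎ : Adj A → Adj B → (A → B → Bool) → Adj (A ⊎ B)
glue⊎ G H c (inj₁ i) (inj₁ j) = G i j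
glue⊎ G H c (inj₁ i) (inj₂ j) = c i j
glue⊎ G H c (inj₂ i) (inj₁ j) = c j i
glue⊎ G H c (inj₂ i) (inj₂ j) = H i j

glue-splitAt : ∀ (G : Graph m) (H : Graph n) c u v →
               glue G H c u v ≡ glue⊎ G H c (splitAt m u) (splitAt m v)
glue-splitAt {m} G H c u v with splitAt m u | splitAt m v
... | inj₁ i | inj₁ j = refl
... | inj₁ i | inj₂ j = refl
... | inj₂ i | inj₁ j = refl
... | inj₂ i | inj₂ j = refl

glue⊎-preserves : ∀ {A′ B′ : Set} {f : A → A′} {g : B → B′} {G₁ G₂ c H₁ H₂ d} →
                  Preserves f G₁ H₁ → Preserves g G₂ H₂ →
                  (∀ i j → c i j ≡ d (f i) (g j)) →
                  Preserves (Sum.map f g) (glue⊎ G₁ G₂ c) (glue⊎ H₁ H₂ d)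
glue⊎-preserves pf pg pc (inj₁ i) (inj₁ j) = pf i j
glue⊎-preserves pf pg pc (inj₁ i) (inj₂ j) = pc i j
glue⊎-preserves pf pg pc (inj₂ i) (inj₁ j) = pc j i
glue⊎-preserves pf pg pc (inj₂ i) (inj₂ j) = pg i j

glue-preserves : ∀ {A′ B′ : Set} {f : Fin m → A′} {g : Fin n → B′} {G₁ G₂ c H₁ H₂ d} →
                 Preserves f G₁ H₁ → Preserves g G₂ H₂ →
                 (∀ i j → c i j ≡ d (f i) (g j)) →
                 Preserves (Sum.map f g ∘ splitAt m) (glue G₁ G₂ c) (glue⊎ H₁ H₂ d)
glue-preserves {m} {G₁ = G₁} {G₂} {c} pf pg pc u v =
  trans (glue-splitAt G₁ G₂ c u v) (glue⊎-preserves pf pg pc (splitAt m u) (splitAt m v))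

-- Rooted expressions as NLC- and clique-width expressions

data RExpr : Set where
  vertex : RExpr
  node   : (link keep : Bool) → RExpr → RExpr → RExpr

Vertex : RExpr → Set
Vertex vertex         = ⊤
Vertex (node _ _ a b) = Vertex a ⊎ Vertex b

isRoot : (t : RExpr) → Vertex t → Bool
isRoot vertex              _        = true
isRoot (node _ _    a b) (inj₁ u) = isRoot a u
isRoot (node _ keep a b) (inj₂ v) = keep ∧ isRoot b v

edges : (t : RExpr) → Adj (Vertex t)
edges vertex              _ _ = false
edges (node link _ a b)       = glue⊎ (edges a) (edges b) (λ u v → link ∧ isRoot a u ∧ isRoot b v)

size : RExpr → ℕ
size vertex         = 1
size (node _ _ a b) = size a + size b

enumeration : (t : RExpr) → Fin (size t) ↔ Vertex t
enumeration vertex         = 1↔⊤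
enumeration (node _ _ a b) = ↔-trans +↔⊎ (⊎-cong (enumeration a) (enumeration b))

lab : Bool → Fin 3
lab true  = 0F
lab false = 1F

mark : Bool → Fin 3
mark true  = 2F
mark false = 1F

rename : Fin 3 → Fin 3 → Fin 3 → Fin 3
rename a b l = if eqLab l a then b else l

mark-lab : ∀ r → rename 0F 2F (lab r) ≡ mark r
mark-lab true  = refl
mark-lab false = refl

settle-lab : ∀ keep r → rename 2F (lab keep) (lab r) ≡ lab r
settle-lab _ true  = refl
settle-lab _ false = refl

settle-mark : ∀ keep r → rename 2F (lab keep) (mark r) ≡ lab (keep ∧ r)
settle-mark true  true  = refl
settle-mark false true  = refl
settle-mark true  false = refl
settle-mark false false = refl

joins : Fin 3 → Fin 3 → Bool
joins l l′ = eqLab l 0F ∧ eqLab l′ 2F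

linked : Fin 3 → Fin 3 → Bool
linked l l′ = joins l l′ ∨ (eqLab l 2F ∧ eqLab l′ 0F)

joins-lab-mark : ∀ p q → joins (lab p) (mark q) ≡ p ∧ q
joins-lab-mark true  true  = refl
joins-lab-mark true  false = refl
joins-lab-mark false _     = refl

linked-lab-lab : ∀ p p′ → linked (lab p) (lab p′) ≡ false
linked-lab-lab true  true  = refl
linked-lab-lab true  false = refl
linked-lab-lab false true  = refl
linked-lab-lab false false = refl

linked-mark-mark : ∀ q q′ → linked (mark q) (mark q′) ≡ false
linked-mark-mark true  true  = refl
linked-mark-mark true  false = refl
linked-mark-mark false true  = refl
linked-mark-mark false false = refl

linked-lab-mark : ∀ p q → linked (lab p) (mark q) ≡ p ∧ q
linked-lab-mark true  true  = refl
linked-lab-mark true  false = refl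
linked-lab-mark false true  = refl
linked-lab-mark false false = refl

linked-mark-lab : ∀ p q → linked (mark q) (lab p) ≡ p ∧ q
linked-mark-lab true  true  = refl
linked-mark-lab true  false = refl
linked-mark-lab false true  = refl
linked-mark-lab false false = refl

-- The labels at a node just after the union: the roots of b still carry 2.
unsettled : (a b : RExpr) → Vertex a ⊎ Vertex b → Fin 3
unsettled a b (inj₁ u) = lab (isRoot a u)
unsettled a b (inj₂ v) = mark (isRoot b v)

RootLabels : (t : RExpr) → (Fin (size t) → Fin 3) → Set
RootLabels t label = ∀ u → label u ≡ lab (isRoot t (to (enumeration t) u))

module _ (a b : RExpr) {la : Fin (size a) → Fin 3} {lb : Fin (size b) → Fin 3}
         (la-roots : RootLabels a la) (lb-roots : RootLabels b lb) where

  unsettled-labels : ∀ z → [ la , rename 0F 2F ∘ lb ] z ≡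
                           unsettled a b (Sum.map (to (enumeration a)) (to (enumeration b)) z)
  unsettled-labels (inj₁ i) = la-roots i
  unsettled-labels (inj₂ j) = trans (cong (rename 0F 2F) (lb-roots j)) (mark-lab _)

  node-labels : ∀ {link keep} → RootLabels (node link keep a b)
                                   (rename 2F (lab keep) ∘ joinLab la (rename 0F 2F ∘ lb))
  node-labels {link} {keep} u =
    trans (cong (rename 2F (lab keep)) (unsettled-labels (splitAt (size a) u)))
      (settled (to (enumeration (node link keep a b)) u))
    where
    settled : ∀ w → rename 2F (lab keep) (unsettled a b w) ≡ lab (isRoot (node link keep a b) w)
    settled (inj₁ u) = settle-lab keep _
    settled (inj₂ v) = settle-mark keep _

toNLC : (t : RExpr) → NLCExpr 3 (size t)
toNLC vertex                = vertex 0F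
toNLC (node link keep a b) =
  relabel (rename 2F (lab keep))
    (times (λ l l′ → link ∧ joins l l′) (toNLC a) (relabel (rename 0F 2F) (toNLC b)))

nlcLab-toNLC : ∀ t → RootLabels t (nlcLab (toNLC t))
nlcLab-toNLC vertex         _ = refl
nlcLab-toNLC (node _ _ a b)   = node-labels a b (nlcLab-toNLC a) (nlcLab-toNLC b)

nlcGraph-toNLC : ∀ t → Preserves (to (enumeration t)) (nlcGraph (toNLC t)) (edges t)
nlcGraph-toNLC vertex               _ _ = refl
nlcGraph-toNLC (node link keep a b)     =
  glue-preserves (nlcGraph-toNLC a) (nlcGraph-toNLC b) λ i j →
    cong (link ∧_) (trans (cong₂ joins (labels (inj₁ i)) (labels (inj₂ j)))
                          (joins-lab-mark (isRoot a _) (isRoot b _)))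
  where labels = unsettled-labels a b (nlcLab-toNLC a) (nlcLab-toNLC b)

toNLC-≃ : ∀ t → nlcGraph (toNLC t) ≃ edges t
toNLC-≃ t = record { bij = enumeration t ; preserve = nlcGraph-toNLC t }

2F≢lab : ∀ keep → 2F ≢ lab keep
2F≢lab true  ()
2F≢lab false ()

unite : CWExpr 3 m → CWExpr 3 n → CWExpr 3 (m + n)
unite e f = union e (relabel 0F 2F (λ ()) f)

settle : Bool → CWExpr 3 n → CWExpr 3 n
settle keep = relabel 2F (lab keep) (2F≢lab keep)

toCW : (t : RExpr) → CWExpr 3 (size t)
toCW vertex                = vertex 0F
toCW (node false keep a b) = settle keep (unite (toCW a) (toCW b))
toCW (node true  keep a b) = settle keep (eta 0F 2F (λ ()) (unite (toCW a) (toCW b)))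

cwLab-toCW : ∀ t → RootLabels t (cwLab (toCW t))
cwLab-toCW vertex                _ = refl
cwLab-toCW (node false keep a b)   = node-labels a b (cwLab-toCW a) (cwLab-toCW b)
cwLab-toCW (node true  keep a b)   = node-labels a b (cwLab-toCW a) (cwLab-toCW b)

linked-unsettled : ∀ {keep} (a b : RExpr) w w′ →
  edges (node false keep a b) w w′ ∨ linked (unsettled a b w) (unsettled a b w′) ≡
  edges (node true keep a b) w w′
linked-unsettled a b (inj₁ u) (inj₁ u′) =
  trans (cong (edges a u u′ ∨_) (linked-lab-lab (isRoot a u) (isRoot a u′))) (∨-identityʳ _)
linked-unsettled a b (inj₁ u) (inj₂ v)  = linked-lab-mark (isRoot a u) (isRoot b v)
linked-unsettled a b (inj₂ v) (inj₁ u)  = linked-mark-lab (isRoot a u) (isRoot b v)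
linked-unsettled a b (inj₂ v) (inj₂ v′) =
  trans (cong (edges b v v′ ∨_) (linked-mark-mark (isRoot b v) (isRoot b v′))) (∨-identityʳ _)

cwGraph-toCW : ∀ t → Preserves (to (enumeration t)) (cwGraph (toCW t)) (edges t)
cwGraph-toCW vertex                _ _ = refl
cwGraph-toCW (node false keep a b)     =
  glue-preserves (cwGraph-toCW a) (cwGraph-toCW b) (λ _ _ → refl)
cwGraph-toCW (node true keep a b) u v  = begin
  cwGraph U u v ∨ linked (cwLab U u) (cwLab U v)
    ≡⟨ cong₂ _∨_ (united u v)
                 (cong₂ linked (labels (splitAt (size a) u)) (labels (splitAt (size a) v))) ⟩
  edges (node false keep a b) (e u) (e v) ∨ linked (unsettled a b (e u)) (unsettled a b (e v))
    ≡⟨ linked-unsettled {keep} a b (e u) (e v) ⟩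
  edges (node true keep a b) (e u) (e v) ∎
  where
  open ≡-Reasoning
  U = unite (toCW a) (toCW b)
  e : Fin (size a + size b) → Vertex a ⊎ Vertex b
  e = to (enumeration (node true keep a b))
  united : Preserves e (cwGraph U) (edges (node false keep a b))
  united = glue-preserves (cwGraph-toCW a) (cwGraph-toCW b) (λ _ _ → refl)
  labels = unsettled-labels a b (cwLab-toCW a) (cwLab-toCW b)

toCW-≃ : ∀ t → cwGraph (toCW t) ≃ edges t
toCW-≃ t = record { bij = enumeration t ; preserve = cwGraph-toCW t }

cographRExpr : CographExpr m → RExpr
cographRExpr vertex      = vertex
cographRExpr (union e f) = node false true (cographRExpr e) (cographRExpr f)
cographRExpr (joinE e f) = node true  true (cographRExpr e) (cographRExpr f)

cographRExpr-isRoot : ∀ (h : CographExpr m) v → isRoot (cographRExpr h) v ≡ true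
cographRExpr-isRoot vertex      _        = refl
cographRExpr-isRoot (union e f) (inj₁ u) = cographRExpr-isRoot e u
cographRExpr-isRoot (union e f) (inj₂ v) = cographRExpr-isRoot f v
cographRExpr-isRoot (joinE e f) (inj₁ u) = cographRExpr-isRoot e u
cographRExpr-isRoot (joinE e f) (inj₂ v) = cographRExpr-isRoot f v

cographEnumeration : (h : CographExpr m) → Fin m ↔ Vertex (cographRExpr h)
cographEnumeration vertex      = 1↔⊤
cographEnumeration (union e f) = ↔-trans +↔⊎ (⊎-cong (cographEnumeration e) (cographEnumeration f))
cographEnumeration (joinE e f) = ↔-trans +↔⊎ (⊎-cong (cographEnumeration e) (cographEnumeration f))

evalCograph-cographRExpr : ∀ (h : CographExpr m) →
  Preserves (to (cographEnumeration h)) (evalCograph h) (edges (cographRExpr h))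
evalCograph-cographRExpr vertex      _ _ = refl
evalCograph-cographRExpr (union e f)     =
  glue-preserves (evalCograph-cographRExpr e) (evalCograph-cographRExpr f) (λ _ _ → refl)
evalCograph-cographRExpr (joinE e f)     =
  glue-preserves (evalCograph-cographRExpr e) (evalCograph-cographRExpr f) λ i j →
    sym (cong₂ _∧_ (cographRExpr-isRoot e _) (cographRExpr-isRoot f _))

evalCograph-≃ : (h : CographExpr m) → evalCograph h ≃ edges (cographRExpr h)
evalCograph-≃ h = record { bij = cographEnumeration h ; preserve = evalCograph-cographRExpr h }

-- Plugging an expression into a vertex

Others : (t : RExpr) → Vertex t → Set
Others vertex         _        = ⊥
Others (node _ _ a b) (inj₁ y) = Others a y ⊎ Vertex b
Others (node _ _ a b) (inj₂ y) = Vertex a ⊎ Others b y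

plug : (t : RExpr) → Vertex t → RExpr → RExpr
plug vertex               _        s = s
plug (node link keep a b) (inj₁ y) s = node link keep (plug a y s) b
plug (node link keep a b) (inj₂ y) s = node link keep a (plug b y s)

⊎-swapʳ : ((A ⊎ B) ⊎ C) ↔ ((A ⊎ C) ⊎ B)
⊎-swapʳ {A} {B} {C} =
  ↔-trans (⊎-assoc 0ℓ A B C) (↔-trans (⊎-cong ↔-refl (⊎-comm B C)) (↔-sym (⊎-assoc 0ℓ A C B)))

punctured : (t : RExpr) (y : Vertex t) → (Others t y ⊎ ⊤) ↔ Vertex t
punctured vertex         _        = ⊎-identityˡ 0ℓ ⊤
punctured (node _ _ a b) (inj₁ y) = ↔-trans ⊎-swapʳ (⊎-cong (punctured a y) ↔-refl)
punctured (node _ _ a b) (inj₂ y) = ↔-trans (⊎-assoc 0ℓ _ _ _) (⊎-cong ↔-refl (punctured b y))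

plugged : (t : RExpr) (y : Vertex t) (s : RExpr) → (Others t y ⊎ Vertex s) ↔ Vertex (plug t y s)
plugged vertex         _        s = ⊎-identityˡ 0ℓ (Vertex s)
plugged (node _ _ a b) (inj₁ y) s = ↔-trans ⊎-swapʳ (⊎-cong (plugged a y s) ↔-refl)
plugged (node _ _ a b) (inj₂ y) s = ↔-trans (⊎-assoc 0ℓ _ _ _) (⊎-cong ↔-refl (plugged b y s))

others : (t : RExpr) (y : Vertex t) → Others t y → Vertex t
others t y h = to (punctured t y) (inj₁ h)

punctured-point : ∀ t y → to (punctured t y) (inj₂ tt) ≡ y
punctured-point vertex         tt       = refl
punctured-point (node _ _ a b) (inj₁ y) = cong inj₁ (punctured-point a y)
punctured-point (node _ _ a b) (inj₂ y) = cong inj₂ (punctured-point b y)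

isRoot-plugged-others : ∀ t y s h →
  isRoot (plug t y s) (to (plugged t y s) (inj₁ h)) ≡ isRoot t (others t y h)
isRoot-plugged-others (node _ _ a b)    (inj₁ y) s (inj₁ h) = isRoot-plugged-others a y s h
isRoot-plugged-others (node _ _ a b)    (inj₁ y) s (inj₂ v) = refl
isRoot-plugged-others (node _ _ a b)    (inj₂ y) s (inj₁ u) = refl
isRoot-plugged-others (node _ keep a b) (inj₂ y) s (inj₂ h) =
  cong (keep ∧_) (isRoot-plugged-others b y s h)

isRoot-plugged-inner : ∀ t y s c →
  isRoot (plug t y s) (to (plugged t y s) (inj₂ c)) ≡ isRoot t y ∧ isRoot s c
isRoot-plugged-inner vertex            _        s c = refl
isRoot-plugged-inner (node _ _ a b)    (inj₁ y) s c = isRoot-plugged-inner a y s c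
isRoot-plugged-inner (node _ keep a b) (inj₂ y) s c =
  trans (cong (keep ∧_) (isRoot-plugged-inner b y s c)) (sym (∧-assoc keep _ _))

substituted : (t : RExpr) (y : Vertex t) (s : RExpr) → Adj (Others t y ⊎ Vertex s)
substituted t y s =
  glue⊎ (λ h h′ → edges t (others t y h) (others t y h′)) (edges s)
        (λ h c → edges t (others t y h) y ∧ isRoot s c)

edges-plug : ∀ t y s → Preserves (to (plugged t y s)) (substituted t y s) (edges (plug t y s))
edges-plug vertex _ s (inj₂ c) (inj₂ c′) = refl
edges-plug (node link keep a b) (inj₁ y) s = λ where
    (inj₁ (inj₁ h)) (inj₁ (inj₁ h′)) → edges-plug a y s (inj₁ h) (inj₁ h′)
    (inj₁ (inj₁ h)) (inj₁ (inj₂ v))  → root-b h v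
    (inj₁ (inj₁ h)) (inj₂ c)         → edges-plug a y s (inj₁ h) (inj₂ c)
    (inj₁ (inj₂ v)) (inj₁ (inj₁ h))  → root-b h v
    (inj₁ (inj₂ v)) (inj₁ (inj₂ v′)) → refl
    (inj₁ (inj₂ v)) (inj₂ c)         → inner-b v c
    (inj₂ c)        (inj₁ (inj₁ h))  → edges-plug a y s (inj₂ c) (inj₁ h)
    (inj₂ c)        (inj₁ (inj₂ v))  → inner-b v c
    (inj₂ c)        (inj₂ c′)        → edges-plug a y s (inj₂ c) (inj₂ c′)
  where
  open ∨-∧-Solver
  root-b : ∀ h v → link ∧ isRoot a (others a y h) ∧ isRoot b v ≡
                   link ∧ isRoot (plug a y s) (to (plugged a y s) (inj₁ h)) ∧ isRoot b v
  root-b h v = cong (λ r → link ∧ r ∧ isRoot b v) (sym (isRoot-plugged-others a y s h))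
  inner-b : ∀ v c → (link ∧ isRoot a y ∧ isRoot b v) ∧ isRoot s c ≡
                    link ∧ isRoot (plug a y s) (to (plugged a y s) (inj₂ c)) ∧ isRoot b v
  inner-b v c = trans
    (solve 4 (λ x r w q → (x :* (r :* w)) :* q := x :* ((r :* q) :* w)) refl
           link (isRoot a y) (isRoot b v) (isRoot s c))
    (cong (λ r → link ∧ r ∧ isRoot b v) (sym (isRoot-plugged-inner a y s c)))
edges-plug (node link keep a b) (inj₂ y) s = λ where
    (inj₁ (inj₁ u)) (inj₁ (inj₁ u′)) → refl
    (inj₁ (inj₁ u)) (inj₁ (inj₂ h))  → root-a u h
    (inj₁ (inj₁ u)) (inj₂ c)         → inner-a u c
    (inj₁ (inj₂ h)) (inj₁ (inj₁ u))  → root-a u h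
    (inj₁ (inj₂ h)) (inj₁ (inj₂ h′)) → edges-plug b y s (inj₁ h) (inj₁ h′)
    (inj₁ (inj₂ h)) (inj₂ c)         → edges-plug b y s (inj₁ h) (inj₂ c)
    (inj₂ c)        (inj₁ (inj₁ u))  → inner-a u c
    (inj₂ c)        (inj₁ (inj₂ h))  → edges-plug b y s (inj₂ c) (inj₁ h)
    (inj₂ c)        (inj₂ c′)        → edges-plug b y s (inj₂ c) (inj₂ c′)
  where
  open ∨-∧-Solver
  root-a : ∀ u h → link ∧ isRoot a u ∧ isRoot b (others b y h) ≡
                   link ∧ isRoot a u ∧ isRoot (plug b y s) (to (plugged b y s) (inj₁ h))
  root-a u h = cong (λ r → link ∧ isRoot a u ∧ r) (sym (isRoot-plugged-others b y s h))
  inner-a : ∀ u c → (link ∧ isRoot a u ∧ isRoot b y) ∧ isRoot s c ≡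
                    link ∧ isRoot a u ∧ isRoot (plug b y s) (to (plugged b y s) (inj₂ c))
  inner-a u c = trans
    (solve 4 (λ x u r q → (x :* (u :* r)) :* q := x :* (u :* (r :* q))) refl
           link (isRoot a u) (isRoot b y) (isRoot s c))
    (cong (λ r → link ∧ isRoot a u ∧ r) (sym (isRoot-plugged-inner b y s c)))

plug-≃ : ∀ t y s → substituted t y s ≃ edges (plug t y s)
plug-≃ t y s = record { bij = plugged t y s ; preserve = edges-plug t y s }

from-punctured-point : ∀ t y → from (punctured t y) y ≡ inj₂ tt
from-punctured-point t y =
  trans (cong (from (punctured t y)) (sym (punctured-point t y)))
        (strictlyInverseʳ (punctured t y) _)

-- Substitution and pendant vertices

delete : Graph (suc n) → Fin (suc n) → Graph n
delete G x i j = G (punchIn x i) (punchIn x j)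

removePoint : (x : Fin (suc n)) → Fin (suc n) ↔ (Fin n ⊎ ⊤)
removePoint {n} x = mk↔ₛ′ split [ punchIn x , (λ _ → x) ] split-join join-split
  where
  split : Fin (suc n) → Fin n ⊎ ⊤
  split u with x ≟ u
  ... | yes _   = inj₂ tt
  ... | no  x≢u = inj₁ (punchOut x≢u)
  split-join : ∀ z → split ([ punchIn x , (λ _ → x) ] z) ≡ z
  split-join (inj₁ i) with x ≟ punchIn x i
  ... | yes x≡i = contradiction (sym x≡i) (punchInᵢ≢i x i)
  ... | no  _   = cong inj₁ (punchOut-punchIn x)
  split-join (inj₂ tt) with x ≟ x
  ... | yes _   = refl
  ... | no  x≢x = contradiction refl x≢x
  join-split : ∀ u → [ punchIn x , (λ _ → x) ] (split u) ≡ u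
  join-split u with x ≟ u
  ... | yes x≡u = x≡u
  ... | no  x≢u = punchIn-punchOut x≢u

module _ (g : (A ⊎ ⊤) ↔ (B ⊎ ⊤)) where

  private
    fromInj₁ : (z : B ⊎ ⊤) → z ≢ inj₂ tt → B
    fromInj₁ (inj₁ b)  _   = b
    fromInj₁ (inj₂ tt) z≢ = contradiction refl z≢

    inj₁-fromInj₁ : ∀ z z≢ → inj₁ (fromInj₁ z z≢) ≡ z
    inj₁-fromInj₁ (inj₁ b)  _   = refl
    inj₁-fromInj₁ (inj₂ tt) z≢ = contradiction refl z≢

  restrict : to g (inj₂ tt) ≡ inj₂ tt → A → B
  restrict g-point a = fromInj₁ (to g (inj₁ a)) λ e →
    case Injection.injective (↔⇒↣ g) (trans e (sym g-point)) of λ ()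

  restrict-inj₁ : ∀ g-point a → inj₁ (restrict g-point a) ≡ to g (inj₁ a)
  restrict-inj₁ g-point a = inj₁-fromInj₁ _ _

restrict-inverse : ∀ (g : (A ⊎ ⊤) ↔ (B ⊎ ⊤)) (h : (B ⊎ ⊤) ↔ (A ⊎ ⊤)) →
                   (∀ z → to g (to h z) ≡ z) → ∀ g-point h-point b →
                   restrict g g-point (restrict h h-point b) ≡ b
restrict-inverse g h g∘h g-point h-point b = inj₁-injective (begin
  inj₁ (restrict g g-point (restrict h h-point b)) ≡⟨ restrict-inj₁ g g-point _ ⟩
  to g (inj₁ (restrict h h-point b))               ≡⟨ cong (to g) (restrict-inj₁ h h-point b) ⟩
  to g (to h (inj₁ b))                             ≡⟨ g∘h (inj₁ b) ⟩
  inj₁ b                                           ∎)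
  where open ≡-Reasoning

⊎-⊤-cancel : (g : (A ⊎ ⊤) ↔ (B ⊎ ⊤)) → to g (inj₂ tt) ≡ inj₂ tt → A ↔ B
⊎-⊤-cancel g g-point = mk↔ₛ′ (restrict g g-point) (restrict (↔-sym g) g⁻¹-point)
  (restrict-inverse g (↔-sym g) (strictlyInverseˡ g) g-point g⁻¹-point)
  (restrict-inverse (↔-sym g) g (strictlyInverseʳ g) g⁻¹-point g-point)
  where
  g⁻¹-point : from g (inj₂ tt) ≡ inj₂ tt
  g⁻¹-point = trans (cong (from g) (sym g-point)) (strictlyInverseʳ g _)

substitute-≃ : ∀ {t s} {G : Graph (suc n)} {H : Graph m} (φ : G ≃ edges t) (x : Fin (suc n)) →
               H ≃ edges s → (∀ c → isRoot s c ≡ true) →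
               G [ x / H ] ≃ edges (plug t (to (bij φ) x) s)
substitute-≃ {n} {t = t} {s} {G} φ x χ s-roots = ≃-trans
  (record { bij      = ↔-trans +↔⊎ (⊎-cong ψ (bij χ))
           ; preserve = glue-preserves rest (preserve χ) cross })
  (plug-≃ t y s)
  where
  y = to (bij φ) x
  g : (Fin n ⊎ ⊤) ↔ (Others t y ⊎ ⊤)
  g = ↔-trans (↔-sym (removePoint x)) (↔-trans (bij φ) (↔-sym (punctured t y)))
  ψ : Fin n ↔ Others t y
  ψ = ⊎-⊤-cancel g (from-punctured-point t y)
  others-ψ : ∀ i → others t y (to ψ i) ≡ to (bij φ) (punchIn x i)
  others-ψ i = trans (cong (to (punctured t y)) (restrict-inj₁ g (from-punctured-point t y) i))
                     (strictlyInverseˡ (punctured t y) _)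
  rest : Preserves (to ψ) (delete G x) (λ h h′ → edges t (others t y h) (others t y h′))
  rest i j = trans (preserve φ _ _) (sym (cong₂ (edges t) (others-ψ i) (others-ψ j)))
  cross : ∀ i j → G (punchIn x i) x ≡ edges t (others t y (to ψ i)) y ∧ isRoot s (to (bij χ) j)
  cross i j = trans (preserve φ _ _) (sym (trans
    (cong₂ (λ v r → edges t v y ∧ r) (others-ψ i) (s-roots _)) (∧-identityʳ _)))

record Pendant {N : ℕ} (T : Graph N) (ℓ p : Fin N) : Set where
  field
    adjacent : T ℓ p ≡ true
    unique   : ∀ w → T ℓ w ≡ true → w ≡ p

rootedEdge : RExpr
rootedEdge = node true false vertex vertex

pendant-≃ : ∀ {t} {T : Graph (suc n)} {ℓ p} → Simple T → Pendant T ℓ p →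
            (φ : delete T ℓ ≃ edges t) (y : Vertex t) → punchIn ℓ (from (bij φ) y) ≡ p →
            T ≃ edges (plug t y rootedEdge)
pendant-≃ {n} {t} {T} {ℓ} {p} simple pendant φ y y↦p =
  ≃-trans (≃-sym (record { bij = ↔-sym π ; preserve = λ a b → sym (placed a b) }))
          (plug-≃ t y rootedEdge)
  where
  open Simple simple
  open Pendant pendant
  π : Fin (suc n) ↔ (Others t y ⊎ Vertex rootedEdge)
  π = ↔-trans (removePoint ℓ)
        (↔-trans (⊎-cong (↔-trans (bij φ) (↔-sym (punctured t y))) ↔-refl) (⊎-assoc 0ℓ _ _ _))
  place : Vertex t → Fin (suc n)
  place v = punchIn ℓ (from (bij φ) v)
  place-edges : ∀ v v′ → T (place v) (place v′) ≡ edges t v v′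
  place-edges v v′ = sym (preserve (≃-sym φ) v v′)
  root≡p : place (to (punctured t y) (inj₂ tt)) ≡ p
  root≡p = trans (cong place (punctured-point t y)) y↦p
  ℓ-others : ∀ h → T ℓ (place (others t y h)) ≡ false
  ℓ-others h = ¬-not λ adj → case
    Injection.injective (↔⇒↣ (punctured t y)) (Injection.injective (↔⇒↣ (↔-sym (bij φ)))
      (punchIn-injective ℓ _ _ (trans (unique _ adj) (sym root≡p)))) of λ ()
  to-inner : ∀ h c → T (place (others t y h)) (from π (inj₂ c)) ≡
                     edges t (others t y h) y ∧ isRoot rootedEdge c
  to-inner h (inj₁ tt) = trans (place-edges _ _)
    (trans (cong (edges t _) (punctured-point t y)) (sym (∧-identityʳ _)))
  to-inner h (inj₂ tt) = trans (symmetric _ _) (trans (ℓ-others h) (sym (∧-zeroʳ _)))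
  inner : ∀ c c′ → T (from π (inj₂ c)) (from π (inj₂ c′)) ≡ edges rootedEdge c c′
  inner (inj₁ tt) (inj₁ tt) = irreflexive _
  inner (inj₁ tt) (inj₂ tt) = trans (cong (λ v → T v ℓ) root≡p) (trans (symmetric p ℓ) adjacent)
  inner (inj₂ tt) (inj₁ tt) = trans (cong (T ℓ) root≡p) adjacent
  inner (inj₂ tt) (inj₂ tt) = irreflexive ℓ
  placed : ∀ a b → T (from π a) (from π b) ≡ substituted t y rootedEdge a b
  placed (inj₁ h) (inj₁ h′) = place-edges _ _
  placed (inj₁ h) (inj₂ c)  = to-inner h c
  placed (inj₂ c) (inj₁ h)  = trans (symmetric _ _) (to-inner h c)
  placed (inj₂ c) (inj₂ c′) = inner c c′

-- Trees

adjacent⇒≢ : ∀ {N} {G : Graph N} → Simple G → ∀ {u v} → G u v ≡ true → u ≢ v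
adjacent⇒≢ simple {u} u~v refl = case trans (sym u~v) (Simple.irreflexive simple u) of λ ()

delete-simple : ∀ {G : Graph (suc n)} x → Simple G → Simple (delete G x)
delete-simple x simple = record
  { symmetric   = λ i j → symmetric (punchIn x i) (punchIn x j)
  ; irreflexive = λ i → irreflexive (punchIn x i)
  }
  where open Simple simple

delete-acyclic : ∀ {G : Graph (suc n)} x → Acyclic G → Acyclic (delete G x)
delete-acyclic x acyclic cycle = acyclic record
  { k = k ; c = punchIn x ∘ c ; distinct = λ e → distinct (punchIn-injective x _ _ e)
  ; consec = consec ; closing = closing }
  where open Cycle cycle

walk-≡ : ∀ {N} {G : Graph N} {a b} → a ≡ b → Walk G a b
walk-≡ refl = here

module _ {T : Graph (suc n)} {ℓ p} (simple : Simple T) (pendant : Pendant T ℓ p) where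
  open Simple simple
  open Pendant pendant

  -- A walk can only pass through ℓ as p, ℓ, p; cutting out that detour avoids ℓ.
  avoid-pendant : ∀ {a b} → Walk T a b → (ℓ≢a : ℓ ≢ a) (ℓ≢b : ℓ ≢ b) →
                  Walk (delete T ℓ) (punchOut ℓ≢a) (punchOut ℓ≢b)
  avoid-pendant here ℓ≢a ℓ≢b = walk-≡ (punchOut-cong ℓ refl)
  avoid-pendant {a} (step {v = v} a~v rest) ℓ≢a ℓ≢b with ℓ ≟ v
  ... | no ℓ≢v = step (trans (cong₂ T (punchIn-punchOut ℓ≢a) (punchIn-punchOut ℓ≢v)) a~v)
                      (avoid-pendant rest ℓ≢v ℓ≢b)
  ... | yes refl with rest
  ...   | here = contradiction refl ℓ≢b
  ...   | step {v = v′} ℓ~v′ rest′ =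
          subst₂ (Walk _) (punchOut-cong ℓ (trans (unique v′ ℓ~v′) (sym a≡p))) refl
                 (avoid-pendant rest′ (adjacent⇒≢ simple ℓ~v′) ℓ≢b)
    where a≡p = unique a (trans (symmetric ℓ a) a~v)

  delete-pendant-connected : Connected T → Connected (delete T ℓ)
  delete-pendant-connected connected u v =
    subst₂ (Walk _) (punchOut-punchIn ℓ) (punchOut-punchIn ℓ)
      (avoid-pendant (connected (punchIn ℓ u) (punchIn ℓ v))
                     (punchInᵢ≢i ℓ u ∘ sym) (punchInᵢ≢i ℓ v ∘ sym))

delete-pendant-tree : ∀ {T : Graph (suc (suc n))} {ℓ p} → IsTree T → Pendant T ℓ p →
                      IsTree (delete T ℓ)
delete-pendant-tree {ℓ = ℓ} isTree pendant = record
  { nonempty  = s≤s z≤n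
  ; simple    = delete-simple ℓ simple
  ; connected = delete-pendant-connected simple pendant connected
  ; acyclic   = delete-acyclic ℓ acyclic
  }
  where open IsTree isTree

record Path {N : ℕ} (G : Graph N) (k : ℕ) : Set where
  field
    c        : Fin (suc k) → Fin N
    distinct : Injective _≡_ _≡_ c
    consec   : ∀ (i : Fin k) → G (c (inject₁ i)) (c (suc i)) ≡ true

module _ {N : ℕ} {G : Graph N} where
  open Path

  edgePath : ∀ {u v} → G u v ≡ true → u ≢ v → Path G 1
  edgePath {u} {v} u~v u≢v =
    record { c = ends ; distinct = ends-distinct ; consec = λ { 0F → u~v } }
    where
    ends : Fin 2 → Fin N
    ends 0F = u
    ends 1F = v
    ends-distinct : Injective _≡_ _≡_ ends
    ends-distinct {0F} {0F} _ = refl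
    ends-distinct {0F} {1F} e = contradiction e u≢v
    ends-distinct {1F} {0F} e = contradiction (sym e) u≢v
    ends-distinct {1F} {1F} _ = refl

  prepend : ∀ {k} (P : Path G k) w → G w (c P 0F) ≡ true → (∀ i → w ≢ c P i) → Path G (suc k)
  prepend P w w~c₀ new = record { c = c′ ; distinct = distinct′ ; consec = consec′ }
    where
    c′ : Fin _ → Fin N
    c′ zero    = w
    c′ (suc i) = c P i
    distinct′ : Injective _≡_ _≡_ c′
    distinct′ {zero}  {zero}  _ = refl
    distinct′ {zero}  {suc j} e = contradiction e (new j)
    distinct′ {suc i} {zero}  e = contradiction (sym e) (new i)
    distinct′ {suc i} {suc j} e = cong suc (distinct P e)
    consec′ : ∀ i → G (c′ (inject₁ i)) (c′ (suc i)) ≡ true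
    consec′ zero    = w~c₀
    consec′ (suc i) = consec P i

  prefix : ∀ {k} (P : Path G k) (i : Fin (suc k)) → Path G (toℕ i)
  prefix P i = record
    { c        = c P ∘ inj
    ; distinct = λ e → inject≤-injective _ _ _ _ (distinct P e)
    ; consec   = λ m →
        trans (cong (λ z → G (c P z) (c P (inj (suc m)))) (inj-inject₁ m)) (consec P _)
    }
    where
    inj : Fin (suc (toℕ i)) → Fin _
    inj m = inject≤ m (toℕ<n i)
    inj-inject₁ : ∀ m → inj (inject₁ m) ≡ inject₁ (inject≤ m _)
    inj-inject₁ m = toℕ-injective (begin
      toℕ (inj (inject₁ m))             ≡⟨ toℕ-inject≤ _ _ ⟩
      toℕ (inject₁ m)                   ≡⟨ toℕ-inject₁ m ⟩
      toℕ m                             ≡⟨ toℕ-inject≤ m _ ⟨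
      toℕ (inject≤ m _)                 ≡⟨ toℕ-inject₁ _ ⟨
      toℕ (inject₁ (inject≤ m _))       ∎)
      where open ≡-Reasoning

  prefix-last : ∀ {k} (P : Path G k) i → c (prefix P i) (fromℕ (toℕ i)) ≡ c P i
  prefix-last P i = cong (c P) (toℕ-injective (trans (toℕ-inject≤ _ _) (toℕ-fromℕ _)))

  chord⇒cycle : ∀ {k} (P : Path G (suc k)) (j : Fin k) →
                G (c P (suc (suc j))) (c P 0F) ≡ true → Cycle G
  chord⇒cycle P j chord = record
    { k = toℕ j ; c = c Q ; distinct = distinct Q ; consec = consec Q
    ; closing = trans (cong (λ z → G z (c P 0F)) (prefix-last P (suc (suc j)))) chord }
    where Q = prefix P (suc (suc j))

walk⇒neighbour : ∀ {N} {G : Graph N} {a b} → a ≢ b → Walk G a b → Σ[ v ∈ Fin N ] G a v ≡ true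
walk⇒neighbour a≢b here                 = contradiction refl a≢b
walk⇒neighbour _   (step {v = v} a~v _) = v , a~v

module _ {T : Graph (suc (suc n))} (isTree : IsTree T) where
  open IsTree isTree
  open Simple simple
  open Path

  private
    FreshNeighbour : ∀ {k} → Path T k → Set
    FreshNeighbour P = Σ[ w ∈ Fin (suc (suc n)) ] T w (c P 0F) ≡ true × (∀ i → w ≢ c P i)

    freshNeighbour? : ∀ {k} (P : Path T k) → Dec (FreshNeighbour P)
    freshNeighbour? P = any? λ w → (T w (c P 0F) Bool.≟ true) ×-dec all? λ i → ¬? (w ≟ c P i)

    stuck⇒pendant : ∀ {k} (P : Path T (suc k)) → ¬ FreshNeighbour P → Pendant T (c P 0F) (c P 1F)
    stuck⇒pendant P stuck = record { adjacent = consec P 0F ; unique = unique }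
      where
      unique : ∀ w → T (c P 0F) w ≡ true → w ≡ c P 1F
      unique w c₀~w with any? (λ i → w ≟ c P i)
      ... | no off =
        contradiction (w , trans (symmetric w _) c₀~w , λ i e → off (i , e)) stuck
      ... | yes (0F , refl)          = contradiction refl (adjacent⇒≢ simple c₀~w)
      ... | yes (1F , w≡c₁)          = w≡c₁
      ... | yes (suc (suc j) , refl) =
        contradiction (chord⇒cycle P j (trans (symmetric _ _) c₀~w)) acyclic

    -- The path grows at its front until the front has no neighbour off the path;
    -- by acyclicity its only neighbour is then the second vertex.  The vertices
    -- of a path are distinct, so N units of fuel suffice.
    grow : ∀ fuel {k} → suc (suc n) ≤ fuel + suc (suc k) → Path T (suc k) →
           Σ[ ℓ ∈ Fin (suc (suc n)) ] Σ[ p ∈ Fin (suc (suc n)) ] Pendant T ℓ p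
    grow fuel bound P with freshNeighbour? P
    grow fuel bound P | no stuck = c P 0F , c P 1F , stuck⇒pendant P stuck
    grow zero bound P | yes (w , w~c₀ , new) =
      contradiction (≤-trans (injective⇒≤ (distinct (prepend P w w~c₀ new))) bound) (<-irrefl refl)
    grow (suc fuel) {k} bound P | yes (w , w~c₀ , new) =
      grow fuel (≤-trans bound (≤-reflexive (sym (+-suc fuel (suc (suc k))))))
                (prepend P w w~c₀ new)

  tree-pendant : Σ[ ℓ ∈ Fin (suc (suc n)) ] Σ[ p ∈ Fin (suc (suc n)) ] Pendant T ℓ p
  tree-pendant with walk⇒neighbour (λ ()) (connected 0F 1F)
  ... | v , 0~v = grow (suc (suc n)) (m≤m+n _ _) (edgePath 0~v (adjacent⇒≢ simple 0~v))

singleVertex-≃ : ∀ {T : Graph 1} → T 0F 0F ≡ false → T ≃ edges vertex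
singleVertex-≃ loopless = record { bij = 1↔⊤ ; preserve = λ { 0F 0F → loopless } }

tree-≃ : ∀ {T : Graph n} → IsTree T → Σ RExpr λ t → T ≃ edges t
tree-≃ {zero}        isTree = contradiction (IsTree.nonempty isTree) λ ()
tree-≃ {suc zero}    isTree = vertex , singleVertex-≃ (Simple.irreflexive (IsTree.simple isTree) 0F)
tree-≃ {suc (suc n)} isTree =
  let ℓ , p , pendant = tree-pendant isTree
      simple          = IsTree.simple isTree
      ℓ≢p             = adjacent⇒≢ simple (Pendant.adjacent pendant)
      t , φ           = tree-≃ (delete-pendant-tree isTree pendant)
      y               = to (bij φ) (punchOut ℓ≢p)
      y↦p             = trans (cong (punchIn ℓ) (strictlyInverseʳ (bij φ) _)) (punchIn-punchOut ℓ≢p)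
  in  plug t y rootedEdge , pendant-≃ simple pendant φ y y↦p

cographTree-≃ : ∀ {G : Graph n} → CographTree G → Σ RExpr λ t → G ≃ edges t
cographTree-≃ (tree isTree)          = tree-≃ isTree
cographTree-≃ (subst ct x (h , H≅h)) with cographTree-≃ ct
... | t , φ = plug t (to (bij φ) x) (cographRExpr h) ,
              substitute-≃ φ x (≃-trans (≃-sym (≅⇒≃ H≅h)) (evalCograph-≃ h)) (cographRExpr-isRoot h)

realise : ∀ {X : ℕ → Set} (⟦_⟧ : ∀ {k} → X k → Graph k) {G : Graph n} (e : X m) →
          ⟦ e ⟧ ≃ G → Σ (X n) λ e′ → ⟦ e′ ⟧ ≅ G
realise ⟦_⟧ e φ with ↔⇒≡ (bij φ)
... | refl = e , ≃⇒≅ φ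

corollary4 : ∀ {n : ℕ} (G : Graph n) → CographTree G →
             NLCWidthAtMost 3 G × CliqueWidthAtMost 3 G
corollary4 G ct with cographTree-≃ ct
... | t , φ = (3 , s≤s z≤n , ≤-refl , realise nlcGraph (toNLC t) (≃-trans (toNLC-≃ t) (≃-sym φ)))
            , (3 , s≤s z≤n , ≤-refl , realise cwGraph (toCW t) (≃-trans (toCW-≃ t) (≃-sym φ)))
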